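{- In $\mathbf{IPF}^I$, for every formula $F$ and distinct variables $x,y$ ($y$ not occurring in $F$): $Ix[F,\exists!x]\vdash\exists y\, Ix[F,x=y]$.
   Context: $\mathbf{IPF}$ is a natural deduction system of intuitionist positive free logic: a first-order language without function symbols, terms constants and parameters, primitive predicate $\exists!$ ("exists"), identity; standard intuitionist rules for $\land,\rightarrow,\lor,\leftrightarrow$, $\bot E$ to atomic conclusions; $\forall I$ (infer $\forall xA$ from a deduction of $A^x_a$, discharging $\exists!a$, $a$ fresh), $\forall E$ (from $\forall xA$, $\exists!t$ infer $A^x_t$), $\exists I$ (from $A^x_t$, $\exists!t$ infer $\exists xA$), $\exists E$ (from $\exists xA$ and a deduction of $C$ from $A^x_a,\exists!a$ infer $C$, discharging them, $a$ fresh); $=I$: axiom $t=t$; $=E$: from $t_1=t_2$ and $A^x_{t_1}$ infer $A^x_{t_2}$ ($A$ atomic). $\mathbf{IPF}^I$ adds formulas $Ix[F,G]$ ("the $F$ is $G$", binding $x$) with rules ($a,b$ fresh parameters not occurring in $F,G,C$ or other open assumptions of the subdeduction, $a\neq t$): $II$: from $F^x_t,G^x_t,\exists!t$ and a deduction of $a=t$ from $F^x_a,\exists!a$ (discharged) infer $Ix[F,G]$; $IE^{1p}$: from $Ix[F,G]$, $F^x_t$, $\exists!t$, a deduction of $a=t$ from $F^x_a,\exists!a$ and a deduction of $C$ from $F^x_b,G^x_b,\exists!b$ (all discharged) infer $C$; $IE^{2p}$: from $Ix[F,\exists!x],\exists!t_1,\exists!t_2,F^x_{t_1},F^x_{t_2},A^x_{t_1}$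 infer $A^x_{t_2}$ ($A$ atomic); $IE^{3p}$: from $Ix[F,\exists!x]$ and a deduction of $C$ from $F^x_a,\exists!a$ (discharged) infer $C$; $IE^{4p}$: from $Ix[F,x=t_2],\exists!t_1,\exists!t_2,F^x_{t_1},A^x_{t_1}$ infer $A^x_{t_2}$ ($A$ atomic); $IE^{5p}$: from $Ix[F,x=t],\exists!t$ and a deduction of $C$ from $F^x_a,\exists!a$ (discharged) infer $C$. -}

module Defs where

open import Data.Nat using (ℕ; _≟_)
open import Data.List using (List; []; _∷_)
open import Data.List.Relation.Unary.All using (All)
open import Data.List.Membership.Propositional using (_∈_)
open import Data.Product using (_×_)
open import Data.Unit using (⊤)
open import Data.Empty using (⊥)
open import Relation.Nullary using (yes; no)
open import Relation.Binary.PropositionalEquality using (_≡_; _≢_)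

data Tm : Set where
  par : ℕ → Tm
  con : ℕ → Tm

-- Term positions in formulas: bound variables or genuine terms.
data Term : Set where
  var : ℕ → Term
  tm  : Tm → Term

infixr 6 _∧'_
infixr 5 _∨'_
infixr 4 _⇒_ _⇔_
infix 8 _≐_

data Formula : Set where
  pred  : ℕ → List Term → Formula
  E!    : Term → Formula
  _≐_   : Term → Term → Formula
  ⊥'    : Formula
  _∧'_  : Formula → Formula → Formula
  _∨'_  : Formula → Formula → Formula
  _⇒_   : Formula → Formula → Formula
  _⇔_   : Formula → Formula → Formula
  ∀'    : ℕ → Formula → Formula
  ∃'    : ℕ → Formula → Formula
  I     : ℕ → Formula → Formula → Formula   -- I x [F , G], binds x in F and G

data Atomic : Formula → Set where
  atPred : ∀ {P ss} → Atomic (pred P ss)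
  atE!   : ∀ {s} → Atomic (E! s)
  atEq   : ∀ {s₁ s₂} → Atomic (s₁ ≐ s₂)

subT : ℕ → Tm → Term → Term
subT x t (var y) with x ≟ y
... | yes _ = tm t
... | no  _ = var y
subT x t (tm s) = tm s

subTs : ℕ → Tm → List Term → List Term
subTs x t [] = []
subTs x t (s ∷ ss) = subT x t s ∷ subTs x t ss

sub : ℕ → Tm → Formula → Formula
sub x t (pred P ss) = pred P (subTs x t ss)
sub x t (E! s) = E! (subT x t s)
sub x t (s₁ ≐ s₂) = subT x t s₁ ≐ subT x t s₂
sub x t ⊥' = ⊥'
sub x t (A ∧' B) = sub x t A ∧' sub x t B
sub x t (A ∨' B) = sub x t A ∨' sub x t B
sub x t (A ⇒ B) = sub x t A ⇒ sub x t B
sub x t (A ⇔ B) = sub x t A ⇔ sub x t B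
sub x t (∀' y A) with x ≟ y
... | yes _ = ∀' y A
... | no  _ = ∀' y (sub x t A)
sub x t (∃' y A) with x ≟ y
... | yes _ = ∃' y A
... | no  _ = ∃' y (sub x t A)
sub x t (I y F G) with x ≟ y
... | yes _ = I y F G
... | no  _ = I y (sub x t F) (sub x t G)

FreshTm : ℕ → Tm → Set
FreshTm a (par b) = a ≢ b
FreshTm a (con c) = ⊤

FreshT : ℕ → Term → Set
FreshT a (var _) = ⊤
FreshT a (tm t) = FreshTm a t

FreshTs : ℕ → List Term → Set
FreshTs a [] = ⊤
FreshTs a (s ∷ ss) = FreshT a s × FreshTs a ss

Fresh : ℕ → Formula → Set
Fresh a (pred P ss) = FreshTs a ss
Fresh a (E! s) = FreshT a s
Fresh a (s₁ ≐ s₂) = FreshT a s₁ × FreshT a s₂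
Fresh a ⊥' = ⊤
Fresh a (A ∧' B) = Fresh a A × Fresh a B
Fresh a (A ∨' B) = Fresh a A × Fresh a B
Fresh a (A ⇒ B) = Fresh a A × Fresh a B
Fresh a (A ⇔ B) = Fresh a A × Fresh a B
Fresh a (∀' y A) = Fresh a A
Fresh a (∃' y A) = Fresh a A
Fresh a (I y F G) = Fresh a F × Fresh a G

FreshCtx : ℕ → List Formula → Set
FreshCtx a Γ = All (Fresh a) Γ

NoVarT : ℕ → Term → Set
NoVarT y (var z) = y ≢ z
NoVarT y (tm _) = ⊤

NoVarTs : ℕ → List Term → Set
NoVarTs y [] = ⊤
NoVarTs y (s ∷ ss) = NoVarT y s × NoVarTs y ss

NoVar : ℕ → Formula → Set
NoVar y (pred P ss) = NoVarTs y ss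
NoVar y (E! s) = NoVarT y s
NoVar y (s₁ ≐ s₂) = NoVarT y s₁ × NoVarT y s₂
NoVar y ⊥' = ⊤
NoVar y (A ∧' B) = NoVar y A × NoVar y B
NoVar y (A ∨' B) = NoVar y A × NoVar y B
NoVar y (A ⇒ B) = NoVar y A × NoVar y B
NoVar y (A ⇔ B) = NoVar y A × NoVar y B
NoVar y (∀' z A) = y ≢ z × NoVar y A
NoVar y (∃' z A) = y ≢ z × NoVar y A
NoVar y (I z F G) = y ≢ z × NoVar y F × NoVar y G

-- Discharged assumptions are added to
-- the context of the subdeduction; eigen-parameter conditions are
-- checked against the whole context.

P! : ℕ → Formula
P! a = E! (tm (par a))

infix 2 _⊢_

data _⊢_ (Γ : List Formula) : Formula → Set where
  hyp  : ∀ {A} → A ∈ Γ → Γ ⊢ A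
  ∧I   : ∀ {A B} → Γ ⊢ A → Γ ⊢ B → Γ ⊢ A ∧' B
  ∧E₁  : ∀ {A B} → Γ ⊢ A ∧' B → Γ ⊢ A
  ∧E₂  : ∀ {A B} → Γ ⊢ A ∧' B → Γ ⊢ B
  ⇒I   : ∀ {A B} → A ∷ Γ ⊢ B → Γ ⊢ A ⇒ B
  ⇒E   : ∀ {A B} → Γ ⊢ A ⇒ B → Γ ⊢ A → Γ ⊢ B
  ∨I₁  : ∀ {A B} → Γ ⊢ A → Γ ⊢ A ∨' B
  ∨I₂  : ∀ {A B} → Γ ⊢ B → Γ ⊢ A ∨' B
  ∨E   : ∀ {A B C} → Γ ⊢ A ∨' B → A ∷ Γ ⊢ C → B ∷ Γ ⊢ C → Γ ⊢ C
  ⇔I   : ∀ {A B} → A ∷ Γ ⊢ B → B ∷ Γ ⊢ A → Γ ⊢ A ⇔ B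
  ⇔E₁  : ∀ {A B} → Γ ⊢ A ⇔ B → Γ ⊢ A → Γ ⊢ B
  ⇔E₂  : ∀ {A B} → Γ ⊢ A ⇔ B → Γ ⊢ B → Γ ⊢ A
  ⊥E   : ∀ {A} → Atomic A → Γ ⊢ ⊥' → Γ ⊢ A
  ∀I   : ∀ {x A} (a : ℕ) → FreshCtx a Γ → Fresh a A →
         P! a ∷ Γ ⊢ sub x (par a) A → Γ ⊢ ∀' x A
  ∀E   : ∀ {x A} (t : Tm) → Γ ⊢ ∀' x A → Γ ⊢ E! (tm t) → Γ ⊢ sub x t A
  ∃I   : ∀ {x A} (t : Tm) → Γ ⊢ sub x t A → Γ ⊢ E! (tm t) → Γ ⊢ ∃' x A
  ∃E   : ∀ {x A C} (a : ℕ) → Γ ⊢ ∃' x A →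
         FreshCtx a Γ → Fresh a A → Fresh a C →
         sub x (par a) A ∷ P! a ∷ Γ ⊢ C → Γ ⊢ C
  =I   : (t : Tm) → Γ ⊢ tm t ≐ tm t
  =E   : ∀ {x A} (t₁ t₂ : Tm) → Atomic A → Γ ⊢ tm t₁ ≐ tm t₂ →
         Γ ⊢ sub x t₁ A → Γ ⊢ sub x t₂ A
  II   : ∀ {x F G} (t : Tm) (a : ℕ) →
         Γ ⊢ sub x t F → Γ ⊢ sub x t G → Γ ⊢ E! (tm t) →
         FreshCtx a Γ → Fresh a F → Fresh a G → FreshTm a t →
         sub x (par a) F ∷ P! a ∷ Γ ⊢ tm (par a) ≐ tm t →
         Γ ⊢ I x F G
  IE1p : ∀ {x F G C} (t : Tm) (a b : ℕ) →
         Γ ⊢ I x F G → Γ ⊢ sub x t F → Γ ⊢ E! (tm t) →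
         FreshCtx a Γ → Fresh a F → Fresh a G → Fresh a C → FreshTm a t →
         sub x (par a) F ∷ P! a ∷ Γ ⊢ tm (par a) ≐ tm t →
         FreshCtx b Γ → Fresh b F → Fresh b G → Fresh b C →
         sub x (par b) F ∷ sub x (par b) G ∷ P! b ∷ Γ ⊢ C →
         Γ ⊢ C
  IE2p : ∀ {x F A} (t₁ t₂ : Tm) → Atomic A →
         Γ ⊢ I x F (E! (var x)) → Γ ⊢ E! (tm t₁) → Γ ⊢ E! (tm t₂) →
         Γ ⊢ sub x t₁ F → Γ ⊢ sub x t₂ F → Γ ⊢ sub x t₁ A →
         Γ ⊢ sub x t₂ A
  IE3p : ∀ {x F C} (a : ℕ) →
         Γ ⊢ I x F (E! (var x)) →
         FreshCtx a Γ → Fresh a F → Fresh a C →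
         sub x (par a) F ∷ P! a ∷ Γ ⊢ C → Γ ⊢ C
  IE4p : ∀ {x F A} (t₁ t₂ : Tm) → Atomic A →
         Γ ⊢ I x F (var x ≐ tm t₂) → Γ ⊢ E! (tm t₁) → Γ ⊢ E! (tm t₂) →
         Γ ⊢ sub x t₁ F → Γ ⊢ sub x t₁ A → Γ ⊢ sub x t₂ A
  IE5p : ∀ {x F C} (t : Tm) (a : ℕ) →
         Γ ⊢ I x F (var x ≐ tm t) → Γ ⊢ E! (tm t) →
         FreshCtx a Γ → Fresh a F → Fresh a C → FreshTm a t →
         sub x (par a) F ∷ P! a ∷ Γ ⊢ C → Γ ⊢ C

-- Eliminating  Ix[F, ∃!x]  by IE³ᵖ yields a parameter a with F(a) and ∃!a, which
-- serves as the witness for y.  To conclude  Ix[F, x = a]  by II it remains to show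
-- that every b with F(b) and ∃!b equals a: apply IE²ᵖ to the atomic formula  x = a,
-- transporting the instance  a = a  of =I from a to b.
{-# OPTIONS --safe #-}
module Submission where

open import Defs
open import Data.Nat using (ℕ; suc; _<_; _⊔_; _≟_)
open import Data.Nat.Properties using (m⊔n<o⇒m<o; m⊔n<o⇒n<o; >⇒≢; n<1+n; m<n⇒m<1+n; 1+n≢n)
open import Data.List using (List; []; _∷_)
open import Data.List.Relation.Unary.All using ([]; _∷_)
open import Data.List.Membership.Propositional using (_∈_)
open import Data.List.Relation.Unary.Any using (here; there)
open import Data.Product using (_,_)
open import Data.Unit using (tt)
open import Data.Empty using (⊥-elim)
open import Relation.Nullary using (yes; no)
open import Relation.Binary.PropositionalEquality using (_≡_; _≢_; refl; sym; cong; cong₂; subst)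

subT-self : ∀ x t → subT x t (var x) ≡ tm t
subT-self x t with x ≟ x
... | yes _  = refl
... | no x≢x = ⊥-elim (x≢x refl)

subT-other : ∀ {y x} t → y ≢ x → subT y t (var x) ≡ var x
subT-other {y} {x} t y≢x with y ≟ x
... | yes y≡x = ⊥-elim (y≢x y≡x)
... | no _    = refl

subT-NoVarT : ∀ y t s → NoVarT y s → subT y t s ≡ s
subT-NoVarT y t (var z) y≢z = subT-other t y≢z
subT-NoVarT y t (tm s)  _   = refl

subTs-NoVarTs : ∀ y t ss → NoVarTs y ss → subTs y t ss ≡ ss
subTs-NoVarTs y t []       _          = refl
subTs-NoVarTs y t (s ∷ ss) (ns , nss) =
  cong₂ _∷_ (subT-NoVarT y t s ns) (subTs-NoVarTs y t ss nss)

sub-NoVar : ∀ y t A → NoVar y A → sub y t A ≡ A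
sub-NoVar y t (pred P ss) n          = cong (pred P) (subTs-NoVarTs y t ss n)
sub-NoVar y t (E! s)      n          = cong E! (subT-NoVarT y t s n)
sub-NoVar y t (s₁ ≐ s₂)   (n₁ , n₂)  = cong₂ _≐_ (subT-NoVarT y t s₁ n₁) (subT-NoVarT y t s₂ n₂)
sub-NoVar y t ⊥'          _          = refl
sub-NoVar y t (A ∧' B)    (nA , nB)  = cong₂ _∧'_ (sub-NoVar y t A nA) (sub-NoVar y t B nB)
sub-NoVar y t (A ∨' B)    (nA , nB)  = cong₂ _∨'_ (sub-NoVar y t A nA) (sub-NoVar y t B nB)
sub-NoVar y t (A ⇒ B)     (nA , nB)  = cong₂ _⇒_ (sub-NoVar y t A nA) (sub-NoVar y t B nB)
sub-NoVar y t (A ⇔ B)     (nA , nB)  = cong₂ _⇔_ (sub-NoVar y t A nA) (sub-NoVar y t B nB)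
sub-NoVar y t (∀' z A)    (_ , nA) with y ≟ z
... | yes _ = refl
... | no  _ = cong (∀' z) (sub-NoVar y t A nA)
sub-NoVar y t (∃' z A)    (_ , nA) with y ≟ z
... | yes _ = refl
... | no  _ = cong (∃' z) (sub-NoVar y t A nA)
sub-NoVar y t (I z F G)   (_ , nF , nG) with y ≟ z
... | yes _ = refl
... | no  _ = cong₂ (I z) (sub-NoVar y t F nF) (sub-NoVar y t G nG)

FreshT-subT : ∀ b x t s → FreshTm b t → FreshT b s → FreshT b (subT x t s)
FreshT-subT b x t (var z) ft _ with x ≟ z
... | yes _ = ft
... | no  _ = tt
FreshT-subT b x t (tm s)  _  fs = fs

FreshTs-subTs : ∀ b x t ss → FreshTm b t → FreshTs b ss → FreshTs b (subTs x t ss)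
FreshTs-subTs b x t []       _  _          = tt
FreshTs-subTs b x t (s ∷ ss) ft (fs , fss) =
  FreshT-subT b x t s ft fs , FreshTs-subTs b x t ss ft fss

Fresh-sub : ∀ b x t A → FreshTm b t → Fresh b A → Fresh b (sub x t A)
Fresh-sub b x t (pred P ss) ft f         = FreshTs-subTs b x t ss ft f
Fresh-sub b x t (E! s)      ft f         = FreshT-subT b x t s ft f
Fresh-sub b x t (s₁ ≐ s₂)   ft (f₁ , f₂) = FreshT-subT b x t s₁ ft f₁ , FreshT-subT b x t s₂ ft f₂
Fresh-sub b x t ⊥'          _  _         = tt
Fresh-sub b x t (A ∧' B)    ft (fA , fB) = Fresh-sub b x t A ft fA , Fresh-sub b x t B ft fB
Fresh-sub b x t (A ∨' B)    ft (fA , fB) = Fresh-sub b x t A ft fA , Fresh-sub b x t B ft fB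
Fresh-sub b x t (A ⇒ B)     ft (fA , fB) = Fresh-sub b x t A ft fA , Fresh-sub b x t B ft fB
Fresh-sub b x t (A ⇔ B)     ft (fA , fB) = Fresh-sub b x t A ft fA , Fresh-sub b x t B ft fB
Fresh-sub b x t (∀' z A)    ft fA with x ≟ z
... | yes _ = fA
... | no  _ = Fresh-sub b x t A ft fA
Fresh-sub b x t (∃' z A)    ft fA with x ≟ z
... | yes _ = fA
... | no  _ = Fresh-sub b x t A ft fA
Fresh-sub b x t (I z F G)   ft (fF , fG) with x ≟ z
... | yes _ = fF , fG
... | no  _ = Fresh-sub b x t F ft fF , Fresh-sub b x t G ft fG

maxParT : Term → ℕ
maxParT (var _)       = 0
maxParT (tm (par b))  = b
maxParT (tm (con _))  = 0

maxParTs : List Term → ℕ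
maxParTs []       = 0
maxParTs (s ∷ ss) = maxParT s ⊔ maxParTs ss

maxPar : Formula → ℕ
maxPar (pred _ ss) = maxParTs ss
maxPar (E! s)      = maxParT s
maxPar (s₁ ≐ s₂)   = maxParT s₁ ⊔ maxParT s₂
maxPar ⊥'          = 0
maxPar (A ∧' B)    = maxPar A ⊔ maxPar B
maxPar (A ∨' B)    = maxPar A ⊔ maxPar B
maxPar (A ⇒ B)     = maxPar A ⊔ maxPar B
maxPar (A ⇔ B)     = maxPar A ⊔ maxPar B
maxPar (∀' _ A)    = maxPar A
maxPar (∃' _ A)    = maxPar A
maxPar (I _ F G)   = maxPar F ⊔ maxPar G

FreshT-maxParT : ∀ a s → maxParT s < a → FreshT a s
FreshT-maxParT a (var _)      _ = tt
FreshT-maxParT a (tm (par b)) p = >⇒≢ p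
FreshT-maxParT a (tm (con _)) _ = tt

FreshTs-maxParTs : ∀ a ss → maxParTs ss < a → FreshTs a ss
FreshTs-maxParTs a []       _ = tt
FreshTs-maxParTs a (s ∷ ss) p =
  FreshT-maxParT a s (m⊔n<o⇒m<o _ _ p) , FreshTs-maxParTs a ss (m⊔n<o⇒n<o _ _ p)

Fresh-maxPar : ∀ a A → maxPar A < a → Fresh a A
Fresh-maxPar a (pred _ ss) p = FreshTs-maxParTs a ss p
Fresh-maxPar a (E! s)      p = FreshT-maxParT a s p
Fresh-maxPar a (s₁ ≐ s₂)   p = FreshT-maxParT a s₁ (m⊔n<o⇒m<o _ _ p) , FreshT-maxParT a s₂ (m⊔n<o⇒n<o _ _ p)
Fresh-maxPar a ⊥'          _ = tt
Fresh-maxPar a (A ∧' B)    p = Fresh-maxPar a A (m⊔n<o⇒m<o _ _ p) , Fresh-maxPar a B (m⊔n<o⇒n<o _ _ p)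
Fresh-maxPar a (A ∨' B)    p = Fresh-maxPar a A (m⊔n<o⇒m<o _ _ p) , Fresh-maxPar a B (m⊔n<o⇒n<o _ _ p)
Fresh-maxPar a (A ⇒ B)     p = Fresh-maxPar a A (m⊔n<o⇒m<o _ _ p) , Fresh-maxPar a B (m⊔n<o⇒n<o _ _ p)
Fresh-maxPar a (A ⇔ B)     p = Fresh-maxPar a A (m⊔n<o⇒m<o _ _ p) , Fresh-maxPar a B (m⊔n<o⇒n<o _ _ p)
Fresh-maxPar a (∀' _ A)    p = Fresh-maxPar a A p
Fresh-maxPar a (∃' _ A)    p = Fresh-maxPar a A p
Fresh-maxPar a (I _ F G)   p = Fresh-maxPar a F (m⊔n<o⇒m<o _ _ p) , Fresh-maxPar a G (m⊔n<o⇒n<o _ _ p)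

sub-var≐ : ∀ x t s → sub x t (var x ≐ tm s) ≡ (tm t ≐ tm s)
sub-var≐ x t s = cong (_≐ tm s) (subT-self x t)

sub-I-var≐var : ∀ F {x y} t → x ≢ y → NoVar y F →
                sub y t (I x F (var x ≐ var y)) ≡ I x F (var x ≐ tm t)
sub-I-var≐var F {x} {y} t x≢y y∉F with y ≟ x
... | yes y≡x = ⊥-elim (x≢y (sym y≡x))
... | no  y≢x = cong₂ (I x) (sub-NoVar y t F y∉F)
                            (cong₂ _≐_ (subT-other t y≢x) (subT-self y t))

=I-sub : ∀ {Γ} x t → Γ ⊢ sub x t (var x ≐ tm t)
=I-sub {Γ} x t = subst (Γ ⊢_) (sym (sub-var≐ x t t)) (=I t)

I-E!-unique : ∀ {Γ x F} t₁ t₂ → Γ ⊢ I x F (E! (var x)) →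
              Γ ⊢ E! (tm t₁) → Γ ⊢ E! (tm t₂) → Γ ⊢ sub x t₁ F → Γ ⊢ sub x t₂ F →
              Γ ⊢ tm t₂ ≐ tm t₁
I-E!-unique {Γ} {x} t₁ t₂ ⊢I ⊢t₁ ⊢t₂ ⊢Ft₁ ⊢Ft₂ =
  subst (Γ ⊢_) (sub-var≐ x t₂ t₁)
    (IE2p {A = var x ≐ tm t₁} t₁ t₂ atEq ⊢I ⊢t₁ ⊢t₂ ⊢Ft₁ ⊢Ft₂ (=I-sub x t₁))

I-E!⇒I-≐ : ∀ {Γ x F} t b → I x F (E! (var x)) ∈ Γ → sub x t F ∈ Γ → E! (tm t) ∈ Γ →
           FreshCtx b Γ → Fresh b F → FreshTm b t →
           Γ ⊢ I x F (var x ≐ tm t)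
I-E!⇒I-≐ t b I∈ Ft∈ t∈ bΓ bF bt =
  II t b (hyp Ft∈) (=I-sub _ t) (hyp t∈) bΓ bF (tt , bt) bt
    (I-E!-unique t (par b) (hyp (there (there I∈))) (hyp (there (there t∈)))
                 (hyp (there (here refl))) (hyp (there (there Ft∈))) (hyp (here refl)))

mainTheorem12 : (F : Formula) (x y : ℕ) → x ≢ y → NoVar y F →
                I x F (E! (var x)) ∷ [] ⊢ ∃' y (I x F (var x ≐ var y))
mainTheorem12 F x y x≢y y∉F =
  IE3p a (hyp (here refl)) ((aF , tt) ∷ []) aF (aF , tt , tt)
    (∃I (par a)
      (subst (Γₐ ⊢_) (sym (sub-I-var≐var F (par a) x≢y y∉F))
        (I-E!⇒I-≐ (par a) b (there (there (here refl))) (here refl) (there (here refl))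
          (Fresh-sub b x (par a) F b≢a bF ∷ b≢a ∷ (bF , tt) ∷ []) bF b≢a))
      (hyp (there (here refl))))
  where
  a b : ℕ
  a = suc (maxPar F)
  b = suc a
  aF : Fresh a F
  aF = Fresh-maxPar a F (n<1+n _)
  bF : Fresh b F
  bF = Fresh-maxPar b F (m<n⇒m<1+n (n<1+n _))
  b≢a : b ≢ a
  b≢a = 1+n≢n
  Γₐ : List Formula
  Γₐ = sub x (par a) F ∷ P! a ∷ I x F (E! (var x)) ∷ []
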